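{- The exorcism group $\mathbb{X}_0(\mathbf{CG})$ is isomorphic to the group of formal power series of the form $1+\sum_{n\ge1}t_nx^n$ (with $t_n\in\Bbbk$) under multiplication.
   Context: Let $\Bbbk$ be a field of characteristic 0. $\mathbf{CG}$ is the Hopf algebra of lattices of order ideals of chain gangs with phantoms; concretely, as a graded algebra $\mathbf{CG}=\Bbbk[F,C_1,C_2,\dots]$ is the free polynomial algebra on $F$ (degree 1, a single phantom) and $C_n$ (degree $n$, the chain of order ideals of an $n$-element chain), with $C_0=1$, and its coproduct is the algebra morphism determined by $\Delta(F)=1\otimes F+F\otimes1$ and $\Delta(C_n)=1\otimes C_n+\sum_{m=1}^n\sum_{j=0}^{n-m}\binom{n-m}{j}C_{j+1}\otimes C_{m-1}F^{n-m-j}$. A character of $\mathbf{CG}$ is a unital algebra homomorphism $\zeta:\mathbf{CG}\to\Bbbk$; characters form a group $\mathbb{X}(\mathbf{CG})$ under convolution $(\chi*\phi)(x)=\sum\chi(x_{(1)})\phi(x_{(2)})$, where $\Delta(x)=\sum x_{(1)}\otimes x_{(2)}$, with identity the counit and inverse $\chi\circ\mathrm{S}$. The exorcism group is the subgroup $\mathbb{X}_0(\mathbf{CG})=\{\zeta\in\mathbb{X}(\mathbf{CG}):\zeta(F)=0\}$. -}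

module Defs where

open import Level using (_⊔_)
open import Data.Nat using (ℕ; zero; suc; _∸_)
open import Data.Nat.Combinatorics using () renaming (_C_ to binom)
open import Data.List using (List; []; _∷_; _++_; map; concatMap; replicate; upTo; foldr)
open import Data.Product using (_×_; _,_; Σ; ∃)
open import Relation.Nullary using (¬_)
open import Algebra.Bundles using (CommutativeRing)
import Algebra.Definitions.RawMonoid as RawMonoidDefs

record Field (c ℓ : Level.Level) : Set (Level.suc (c ⊔ ℓ)) where
  field
    commutativeRing : CommutativeRing c ℓ
  open CommutativeRing commutativeRing public
  field
    1≉0     : ¬ (1# ≈ 0#)
    inverse : ∀ x → ¬ (x ≈ 0#) → Σ Carrier λ y → x * y ≈ 1#

CharZero : ∀ {c ℓ} → Field c ℓ → Set ℓ
CharZero K = ∀ n → ¬ (suc n ·ℕ 1# ≈ 0#)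
  where
  open Field K
  open RawMonoidDefs +-rawMonoid using () renaming (_×_ to _·ℕ_)

module CGDefs {c ℓ} (K : Field c ℓ) where
  open Field K

  -- Terms of the free commutative k-algebra k[F, C₁, C₂, …];
  -- gen n stands for the generator C_{n+1}.
  data Term : Set c where
    const : Carrier → Term
    F     : Term
    gen   : ℕ → Term
    _⊕_   : Term → Term → Term
    _⊛_   : Term → Term → Term

  one : Term
  one = const 1#

  Ch : ℕ → Term
  Ch zero    = one
  Ch (suc n) = gen n

  Fpow : ℕ → Term
  Fpow zero    = one
  Fpow (suc k) = F ⊛ Fpow k

  -- Elements of CG ⊗ CG, written as formal finite sums of simple tensors.
  Tensor : Set c
  Tensor = List (Term × Term)

  -- Δ(C_n) = 1 ⊗ C_n + Σ_{m=1}^{n} Σ_{j=0}^{n-m} binom(n-m, j) C_{j+1} ⊗ C_{m-1} F^{n-m-j}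
  -- (the integer coefficient binom(n-m,j) is realised by repeating the simple tensor).
  ΔC : ℕ → Tensor
  ΔC n = (one , Ch n) ∷
         concatMap (λ m → concatMap (λ j →
             replicate (binom (n ∸ m) j) (Ch (suc j) , (Ch (m ∸ 1) ⊛ Fpow (n ∸ m ∸ j))))
           (upTo (suc (n ∸ m))))
         (map suc (upTo n))

  Δ : Term → Tensor
  Δ (const a) = (const a , one) ∷ []
  Δ F         = (one , F) ∷ (F , one) ∷ []
  Δ (gen n)   = ΔC (suc n)
  Δ (s ⊕ t)   = Δ s ++ Δ t
  Δ (s ⊛ t)   = concatMap (λ { (a , b) → map (λ { (a′ , b′) → (a ⊛ a′ , b ⊛ b′) }) (Δ t) }) (Δ s)

  sumK : List Carrier → Carrier
  sumK = foldr _+_ 0#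

  record Character : Set (c ⊔ ℓ) where
    field
      ζ      : Term → Carrier
      ζ-const : ∀ a → ζ (const a) ≈ a
      ζ-⊕     : ∀ s t → ζ (s ⊕ t) ≈ ζ s + ζ t
      ζ-⊛     : ∀ s t → ζ (s ⊛ t) ≈ ζ s * ζ t
  open Character public

  conv : Character → Character → Term → Carrier
  conv χ φ x = sumK (map (λ { (a , b) → ζ χ a * ζ φ b }) (Δ x))

  record X0 : Set (c ⊔ ℓ) where
    field
      char    : Character
      phantom : ζ char F ≈ 0#
  open X0 public

  _≈X_ : X0 → X0 → Set (c ⊔ ℓ)
  χ ≈X ψ = ∀ x → ζ (char χ) x ≈ ζ (char ψ) x

  record PS : Set (c ⊔ ℓ) where
    field
      coeff  : ℕ → Carrier
      coeff0 : coeff 0 ≈ 1#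
  open PS public

  _≈P_ : PS → PS → Set ℓ
  p ≈P q = ∀ n → coeff p n ≈ coeff q n

  mulCoeff : (ℕ → Carrier) → (ℕ → Carrier) → ℕ → Carrier
  mulCoeff f g n = sumK (map (λ i → f i * g (n ∸ i)) (upTo (suc n)))

  -- Group isomorphism X₀(CG) ≅ (1 + x k[[x]], ·): X₀ is closed under convolution,
  -- and there is a bijection (w.r.t. the natural equalities) carrying
  -- convolution to multiplication of power series.
  IsoExorcism : Set (c ⊔ ℓ)
  IsoExorcism =
    (∀ χ φ → Σ X0 λ ψ → ∀ x → ζ (char ψ) x ≈ conv (char χ) (char φ) x) ×
    Σ (X0 → PS) λ Φ →
      (∀ χ ψ → χ ≈X ψ → Φ χ ≈P Φ ψ) ×
      (∀ χ ψ → Φ χ ≈P Φ ψ → χ ≈X ψ) ×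
      (∀ p → Σ X0 λ χ → Φ χ ≈P p) ×
      (∀ χ φ ψ → (∀ x → ζ (char ψ) x ≈ conv (char χ) (char φ) x) →
         ∀ n → coeff (Φ ψ) n ≈ mulCoeff (coeff (Φ χ)) (coeff (Φ φ)) n)

-- A character of the free algebra CG is determined by its values on F and on the
-- generators C_n, and any choice of values is realised; an exorcised character is
-- therefore the same thing as the series 1 + Σ ζ(C_n) xⁿ. For convolution, evaluating
-- Δ(C_n) with φ(F) = 0 kills every term of the binomial sum except j = n − m,
-- leaving χ(1)φ(C_n) + Σ_m χ(C_{n−m+1}) φ(C_{m−1}), which is the coefficient of xⁿ
-- in the product of the two series.
module Submission where

open import Level using (Level)
open import Defs
open import Algebra.Bundles using (Semiring)
import Algebra.Properties.CommutativeSemigroup as CommutativeSemigroupProperties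
open import Data.Nat using (ℕ; zero; suc; _∸_; _<_; s≤s; z<s)
open import Data.Nat.Properties using (+-∸-assoc; m∸[m∸n]≡n; n∸n≡0)
open import Data.Nat.Combinatorics using (nCn≡1) renaming (_C_ to binom)
open import Data.List
  using (List; []; _∷_; _++_; [_]; map; concatMap; replicate; upTo; applyUpTo; applyDownFrom; reverse; foldr)
open import Data.List.Properties
  using (map-++; map-∘; map-upTo; map-applyUpTo; map-replicate; applyUpTo-∷ʳ; reverse-applyUpTo)
import Data.List.Relation.Binary.Permutation.Setoid.Properties as PermutationProperties
open import Data.Product using (_×_; _,_)
open import Function using (_∘_)
open import Relation.Binary.PropositionalEquality as ≡ using (_≡_)
import Relation.Binary.Reasoning.Setoid as SetoidReasoning

applyDownFrom≡applyUpTo : ∀ {a} {A : Set a} (f : ℕ → A) n →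
  applyDownFrom f n ≡ applyUpTo (λ k → f (n ∸ suc k)) n
applyDownFrom≡applyUpTo f zero    = ≡.refl
applyDownFrom≡applyUpTo f (suc n) = ≡.cong (f n ∷_) (applyDownFrom≡applyUpTo f n)

n∸suc[n∸suc[k]]≡k : ∀ {n k} → k < n → n ∸ suc (n ∸ suc k) ≡ k
n∸suc[n∸suc[k]]≡k (s≤s k≤n) = m∸[m∸n]≡n k≤n

module ListSum {c ℓ} (R : Semiring c ℓ) where
  open Semiring R
  open SetoidReasoning setoid

  ∑ : List Carrier → Carrier
  ∑ = foldr _+_ 0#

  ∑-++ : ∀ xs ys → ∑ (xs ++ ys) ≈ ∑ xs + ∑ ys
  ∑-++ []       ys = sym (+-identityˡ _)
  ∑-++ (x ∷ xs) ys = trans (+-congˡ (∑-++ xs ys)) (sym (+-assoc _ _ _))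

  ∑-map-++ : ∀ {a} {A : Set a} (f : A → Carrier) xs ys →
    ∑ (map f (xs ++ ys)) ≈ ∑ (map f xs) + ∑ (map f ys)
  ∑-map-++ f xs ys = trans (reflexive (≡.cong ∑ (map-++ f xs ys))) (∑-++ (map f xs) (map f ys))

  ∑-map-concatMap : ∀ {a b} {A : Set a} {B : Set b} (f : B → Carrier) (G : A → List B) xs →
    ∑ (map f (concatMap G xs)) ≈ ∑ (map (λ x → ∑ (map f (G x))) xs)
  ∑-map-concatMap f G []       = refl
  ∑-map-concatMap f G (x ∷ xs) =
    trans (∑-map-++ f (G x) (concatMap G xs)) (+-congˡ (∑-map-concatMap f G xs))

  ∑-map-cong : ∀ {a} {A : Set a} {f g : A → Carrier} → (∀ x → f x ≈ g x) →
    ∀ xs → ∑ (map f xs) ≈ ∑ (map g xs)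
  ∑-map-cong f≈g []       = refl
  ∑-map-cong f≈g (x ∷ xs) = +-cong (f≈g x) (∑-map-cong f≈g xs)

  ∑-map-*ˡ : ∀ {a} {A : Set a} k (f : A → Carrier) xs →
    ∑ (map (λ x → k * f x) xs) ≈ k * ∑ (map f xs)
  ∑-map-*ˡ k f []       = sym (zeroʳ k)
  ∑-map-*ˡ k f (x ∷ xs) = trans (+-congˡ (∑-map-*ˡ k f xs)) (sym (distribˡ k _ _))

  ∑-map-*ʳ : ∀ {a} {A : Set a} k (f : A → Carrier) xs →
    ∑ (map (λ x → f x * k) xs) ≈ ∑ (map f xs) * k
  ∑-map-*ʳ k f []       = sym (zeroˡ k)
  ∑-map-*ʳ k f (x ∷ xs) = trans (+-congˡ (∑-map-*ʳ k f xs)) (sym (distribʳ k _ _))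

  ∑-replicate-zero : ∀ {x} → x ≈ 0# → ∀ k → ∑ (replicate k x) ≈ 0#
  ∑-replicate-zero x≈0 zero    = refl
  ∑-replicate-zero x≈0 (suc k) = trans (+-cong x≈0 (∑-replicate-zero x≈0 k)) (+-identityˡ 0#)

  ∑-applyUpTo-cong : ∀ {f g : ℕ → Carrier} n → (∀ k → k < n → f k ≈ g k) →
    ∑ (applyUpTo f n) ≈ ∑ (applyUpTo g n)
  ∑-applyUpTo-cong zero    f≈g = refl
  ∑-applyUpTo-cong (suc n) f≈g =
    +-cong (f≈g 0 z<s) (∑-applyUpTo-cong n (λ k k<n → f≈g (suc k) (s≤s k<n)))

  ∑-applyUpTo-zero : ∀ {f : ℕ → Carrier} n → (∀ k → k < n → f k ≈ 0#) → ∑ (applyUpTo f n) ≈ 0#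
  ∑-applyUpTo-zero zero    f≈0 = refl
  ∑-applyUpTo-zero (suc n) f≈0 =
    trans (+-cong (f≈0 0 z<s) (∑-applyUpTo-zero n (λ k k<n → f≈0 (suc k) (s≤s k<n))))
          (+-identityˡ 0#)

  ∑-applyUpTo-last : ∀ {f : ℕ → Carrier} n → (∀ k → k < n → f k ≈ 0#) →
    ∑ (applyUpTo f (suc n)) ≈ f n
  ∑-applyUpTo-last {f} n f≈0 = begin
    ∑ (applyUpTo f (suc n))         ≡⟨ ≡.cong ∑ (applyUpTo-∷ʳ f n) ⟨
    ∑ (applyUpTo f n ++ [ f n ])    ≈⟨ ∑-++ (applyUpTo f n) [ f n ] ⟩
    ∑ (applyUpTo f n) + (f n + 0#)  ≈⟨ +-cong (∑-applyUpTo-zero n f≈0) (+-identityʳ (f n)) ⟩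
    0# + f n                        ≈⟨ +-identityˡ (f n) ⟩
    f n                             ∎

  ∑-reverse : ∀ xs → ∑ (reverse xs) ≈ ∑ xs
  ∑-reverse xs = foldr-commMonoid +-isCommutativeMonoid (↭-reverse xs)
    where open PermutationProperties setoid using (foldr-commMonoid; ↭-reverse)

  ∑-applyUpTo-reverse : ∀ (f : ℕ → Carrier) n →
    ∑ (applyUpTo f n) ≈ ∑ (applyUpTo (λ k → f (n ∸ suc k)) n)
  ∑-applyUpTo-reverse f n = begin
    ∑ (applyUpTo f n)                        ≈⟨ ∑-reverse (applyUpTo f n) ⟨
    ∑ (reverse (applyUpTo f n))              ≡⟨ ≡.cong ∑ (reverse-applyUpTo f n) ⟩
    ∑ (applyDownFrom f n)                    ≡⟨ ≡.cong ∑ (applyDownFrom≡applyUpTo f n) ⟩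
    ∑ (applyUpTo (λ k → f (n ∸ suc k)) n)  ∎

module Exorcism {c ℓ} (K : Field c ℓ) where
  open Field K
  open CGDefs K
  open ListSum semiring
  open CommutativeSemigroupProperties *-commutativeSemigroup using (interchange)
  open SetoidReasoning setoid

  evalTerm : Carrier → (ℕ → Carrier) → Term → Carrier
  evalTerm t u (const a) = a
  evalTerm t u F         = t
  evalTerm t u (gen n)   = u n
  evalTerm t u (s ⊕ s′)  = evalTerm t u s + evalTerm t u s′
  evalTerm t u (s ⊛ s′)  = evalTerm t u s * evalTerm t u s′

  freeCharacter : Carrier → (ℕ → Carrier) → Character
  freeCharacter t u = record
    { ζ       = evalTerm t u
    ; ζ-const = λ _ → refl
    ; ζ-⊕     = λ _ _ → refl
    ; ζ-⊛     = λ _ _ → refl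
    }

  character-ext : ∀ χ ψ → ζ χ F ≈ ζ ψ F → (∀ n → ζ χ (gen n) ≈ ζ ψ (gen n)) →
    ∀ x → ζ χ x ≈ ζ ψ x
  character-ext χ ψ eqF eqGen (const a) = trans (ζ-const χ a) (sym (ζ-const ψ a))
  character-ext χ ψ eqF eqGen F         = eqF
  character-ext χ ψ eqF eqGen (gen n)   = eqGen n
  character-ext χ ψ eqF eqGen (s ⊕ t)   =
    trans (ζ-⊕ χ s t) (trans (+-cong (character-ext χ ψ eqF eqGen s) (character-ext χ ψ eqF eqGen t))
                             (sym (ζ-⊕ ψ s t)))
  character-ext χ ψ eqF eqGen (s ⊛ t)   =
    trans (ζ-⊛ χ s t) (trans (*-cong (character-ext χ ψ eqF eqGen s) (character-ext χ ψ eqF eqGen t))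
                             (sym (ζ-⊛ ψ s t)))

  evalTensor : Character → Character → Term × Term → Carrier
  evalTensor χ φ (a , b) = ζ χ a * ζ φ b

  evalTensor-⊛ : ∀ χ φ a b a′ b′ →
    evalTensor χ φ (a ⊛ a′ , b ⊛ b′) ≈ evalTensor χ φ (a , b) * evalTensor χ φ (a′ , b′)
  evalTensor-⊛ χ φ a b a′ b′ = trans (*-cong (ζ-⊛ χ a a′) (ζ-⊛ φ b b′)) (interchange _ _ _ _)

  conv-⊛ : ∀ χ φ s t → conv χ φ (s ⊛ t) ≈ conv χ φ s * conv χ φ t
  conv-⊛ χ φ s t = begin
    conv χ φ (s ⊛ t)
      ≈⟨ ∑-map-concatMap (evalTensor χ φ) _ (Δ s) ⟩
    ∑ (map (λ p → ∑ (map (evalTensor χ φ) (map (p ·_) (Δ t)))) (Δ s))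
      ≈⟨ ∑-map-cong (λ p → evalTensor-left p) (Δ s) ⟩
    ∑ (map (λ p → evalTensor χ φ p * conv χ φ t) (Δ s))
      ≈⟨ ∑-map-*ʳ (conv χ φ t) (evalTensor χ φ) (Δ s) ⟩
    conv χ φ s * conv χ φ t
      ∎
    where
    _·_ : Term × Term → Term × Term → Term × Term
    (a , b) · (a′ , b′) = (a ⊛ a′ , b ⊛ b′)

    evalTensor-left : ∀ p → ∑ (map (evalTensor χ φ) (map (p ·_) (Δ t))) ≈ evalTensor χ φ p * conv χ φ t
    evalTensor-left (a , b) = begin
      ∑ (map (evalTensor χ φ) (map ((a , b) ·_) (Δ t)))
        ≡⟨ ≡.cong ∑ (map-∘ (Δ t)) ⟨
      ∑ (map (evalTensor χ φ ∘ ((a , b) ·_)) (Δ t))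
        ≈⟨ ∑-map-cong (λ { (a′ , b′) → evalTensor-⊛ χ φ a b a′ b′ }) (Δ t) ⟩
      ∑ (map (λ q → evalTensor χ φ (a , b) * evalTensor χ φ q) (Δ t))
        ≈⟨ ∑-map-*ˡ (evalTensor χ φ (a , b)) (evalTensor χ φ) (Δ t) ⟩
      evalTensor χ φ (a , b) * conv χ φ t
        ∎

  _⋆_ : Character → Character → Character
  χ ⋆ φ = record
    { ζ       = conv χ φ
    ; ζ-const = λ a → trans (+-identityʳ _) (trans (*-cong (ζ-const χ a) (ζ-const φ 1#)) (*-identityʳ a))
    ; ζ-⊕     = λ s t → ∑-map-++ (evalTensor χ φ) (Δ s) (Δ t)
    ; ζ-⊛     = conv-⊛ χ φ
    }

  _⋆₀_ : X0 → X0 → X0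
  χ ⋆₀ φ = record
    { char    = char χ ⋆ char φ
    ; phantom = begin
        ζ (char χ) one * ζ (char φ) F + (ζ (char χ) F * ζ (char φ) one + 0#)
          ≈⟨ +-cong (*-congˡ (phantom φ)) (+-identityʳ _) ⟩
        ζ (char χ) one * 0# + ζ (char χ) F * ζ (char φ) one
          ≈⟨ +-cong (zeroʳ _) (*-congʳ (phantom χ)) ⟩
        0# + 0# * ζ (char φ) one
          ≈⟨ trans (+-identityˡ _) (zeroˡ _) ⟩
        0#
          ∎
    }

  module Exorcised (φ : Character) (φF≈0 : ζ φ F ≈ 0#) where

    ζ-⊛-Fpow-suc : ∀ y e → ζ φ (y ⊛ Fpow (suc e)) ≈ 0#
    ζ-⊛-Fpow-suc y e = begin
      ζ φ (y ⊛ (F ⊛ Fpow e))           ≈⟨ trans (ζ-⊛ φ y _) (*-congˡ (ζ-⊛ φ F (Fpow e))) ⟩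
      ζ φ y * (ζ φ F * ζ φ (Fpow e))   ≈⟨ *-congˡ (trans (*-congʳ φF≈0) (zeroˡ _)) ⟩
      ζ φ y * 0#                       ≈⟨ zeroʳ _ ⟩
      0#                               ∎

    ζ-⊛-Fpow-zero : ∀ y → ζ φ (y ⊛ Fpow 0) ≈ ζ φ y
    ζ-⊛-Fpow-zero y = trans (ζ-⊛ φ y one) (trans (*-congˡ (ζ-const φ 1#)) (*-identityʳ _))

    binomialTerm : ℕ → ℕ → ℕ → Tensor
    binomialTerm a i j = replicate (binom a j) (Ch (suc j) , Ch i ⊛ Fpow (a ∸ j))

    binomialBlock : ℕ → ℕ → Tensor
    binomialBlock a i = concatMap (binomialTerm a i) (upTo (suc a))

    ∑-binomialBlock : ∀ χ a i →
      ∑ (map (evalTensor χ φ) (binomialBlock a i)) ≈ ζ χ (Ch (suc a)) * ζ φ (Ch i)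
    ∑-binomialBlock χ a i = begin
      ∑ (map (evalTensor χ φ) (binomialBlock a i))  ≈⟨ ∑-map-concatMap (evalTensor χ φ) (binomialTerm a i) (upTo (suc a)) ⟩
      ∑ (map term (upTo (suc a)))                  ≡⟨ ≡.cong ∑ (map-upTo term (suc a)) ⟩
      ∑ (applyUpTo term (suc a))                   ≈⟨ ∑-applyUpTo-last a term-vanishes ⟩
      term a                                       ≡⟨ ≡.cong₂ lastTerm (nCn≡1 a) (n∸n≡0 a) ⟩
      evalTensor χ φ (Ch (suc a) , Ch i ⊛ Fpow 0) + 0#
                                                   ≈⟨ trans (+-identityʳ _) (*-congˡ (ζ-⊛-Fpow-zero (Ch i))) ⟩
      ζ χ (Ch (suc a)) * ζ φ (Ch i)                ∎
      where
      lastTerm : (copies exponent : ℕ) → Carrier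
      lastTerm k e = ∑ (map (evalTensor χ φ) (replicate k (Ch (suc a) , Ch i ⊛ Fpow e)))

      term : ℕ → Carrier
      term j = ∑ (map (evalTensor χ φ) (binomialTerm a i j))

      term-vanishes : ∀ j → j < a → term j ≈ 0#
      term-vanishes j j<a = begin
        term j  ≡⟨ ≡.cong ∑ (map-replicate (evalTensor χ φ) (binom a j) _) ⟩
        ∑ (replicate (binom a j) (ζ χ (Ch (suc j)) * ζ φ (Ch i ⊛ Fpow (a ∸ j))))
                ≈⟨ ∑-replicate-zero (trans (*-congˡ F-power-vanishes) (zeroʳ _)) (binom a j) ⟩
        0#      ∎
        where
        F-power-vanishes : ζ φ (Ch i ⊛ Fpow (a ∸ j)) ≈ 0#
        -- +-∸-assoc 1 j<a : a ∸ j ≡ suc (a ∸ suc j)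
        F-power-vanishes = trans (reflexive (≡.cong (λ e → ζ φ (Ch i ⊛ Fpow e)) (+-∸-assoc 1 j<a)))
                                 (ζ-⊛-Fpow-suc (Ch i) (a ∸ suc j))

    conv-Ch : ∀ χ n → conv χ φ (Ch n) ≈ mulCoeff (ζ χ ∘ Ch) (ζ φ ∘ Ch) n
    conv-Ch χ zero    = refl
    conv-Ch χ (suc n) = +-congˡ (begin
      ∑ (map (evalTensor χ φ) (concatMap block (map suc (upTo (suc n)))))
        ≈⟨ ∑-map-concatMap (evalTensor χ φ) block (map suc (upTo (suc n))) ⟩
      ∑ (map (λ m → ∑ (map (evalTensor χ φ) (block m))) (map suc (upTo (suc n))))
        ≈⟨ ∑-map-cong (λ m → ∑-binomialBlock χ (suc n ∸ m) (m ∸ 1)) (map suc (upTo (suc n))) ⟩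
      ∑ (map (λ m → f (suc (suc n ∸ m)) * g (m ∸ 1)) (map suc (upTo (suc n))))
        ≡⟨ ≡.cong ∑ (≡.trans (≡.sym (map-∘ (upTo (suc n)))) (map-upTo (λ k → f (suc (suc n ∸ suc k)) * g k) (suc n))) ⟩
      ∑ (applyUpTo (λ k → f (suc (suc n ∸ suc k)) * g k) (suc n))
        ≈⟨ ∑-applyUpTo-reverse (λ k → f (suc (suc n ∸ suc k)) * g k) (suc n) ⟩
      ∑ (applyUpTo (λ k → f (suc (suc n ∸ suc (suc n ∸ suc k))) * g (suc n ∸ suc k)) (suc n))
        ≈⟨ ∑-applyUpTo-cong (suc n) (λ k k<n → reflexive
             (≡.cong (λ i → f (suc i) * g (suc n ∸ suc k)) (n∸suc[n∸suc[k]]≡k k<n))) ⟩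
      ∑ (applyUpTo (λ k → f (suc k) * g (suc n ∸ suc k)) (suc n))
        ≡⟨ ≡.cong ∑ (map-applyUpTo suc (λ i → f i * g (suc n ∸ i)) (suc n)) ⟨
      ∑ (map (λ i → f i * g (suc n ∸ i)) (applyUpTo suc (suc n)))
        ∎)
      where
      f g : ℕ → Carrier
      f = ζ χ ∘ Ch
      g = ζ φ ∘ Ch

      block : ℕ → Tensor
      block m = binomialBlock (suc n ∸ m) (m ∸ 1)

  generatingSeries : X0 → PS
  generatingSeries χ = record { coeff = λ n → ζ (char χ) (Ch n) ; coeff0 = ζ-const (char χ) 1# }

  seriesCharacter : PS → X0
  seriesCharacter p = record { char = freeCharacter 0# (λ n → coeff p (suc n)) ; phantom = refl }

  generatingSeries-seriesCharacter : ∀ p → generatingSeries (seriesCharacter p) ≈P p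
  generatingSeries-seriesCharacter p zero    = sym (coeff0 p)
  generatingSeries-seriesCharacter p (suc n) = refl

  isoExorcism : IsoExorcism
  isoExorcism =
      (λ χ φ → χ ⋆₀ φ , λ _ → refl)
    , generatingSeries
    , (λ χ ψ χ≈ψ n → χ≈ψ (Ch n))
    , (λ χ ψ Φχ≈Φψ → character-ext (char χ) (char ψ) (trans (phantom χ) (sym (phantom ψ))) (Φχ≈Φψ ∘ suc))
    , (λ p → seriesCharacter p , generatingSeries-seriesCharacter p)
    , λ χ φ ψ ψ≈χ⋆φ n → trans (ψ≈χ⋆φ (Ch n)) (Exorcised.conv-Ch (char φ) (phantom φ) (char χ) n)

theorem6p2 : ∀ {c ℓ : Level} (K : Field c ℓ) → CharZero K → CGDefs.IsoExorcism K
theorem6p2 K _ = Exorcism.isoExorcism K
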